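{- Let $\overline{pp}_k(n)$ be the number of plane overpartitions of $n$ with exactly $k$ overlined parts. If $k\ge 2n/3$, then $\overline{pp}_k(n)=\overline{pp}_{k+1}(n+1)$.
   Context: A plane partition of $n$ is an array of positive integers, justified to the upper-left, weakly decreasing along each row (left to right) and each column (top to bottom), with entries summing to $n$. A plane overpartition is a plane partition in which some entries are overlined according to the rules: in each row, only the last occurrence of an integer may be overlined (optionally); in each column, all but the first occurrence of an integer must be overlined, while the first occurrence may or may not be overlined. The weight $n$ is the sum of the entries (overlined or not). -}

module Defs where

open import Data.Nat using (ℕ; zero; suc; _+_; _≤_; _<_)
open import Data.Bool using (Bool; true; false)
open import Data.Maybe using (Maybe; just; nothing)
open import Data.Product using (_×_; proj₁; proj₂)
open import Data.List using (List; []; _∷_; length; map; concat; mapMaybe)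
open import Data.Nat.ListAction using (sum)
open import Data.List.Relation.Unary.All using (All)
open import Data.List.Relation.Unary.AllPairs using (AllPairs)
open import Relation.Binary.PropositionalEquality using (_≡_)

Entry : Set
Entry = ℕ × Bool

value : Entry → ℕ
value = proj₁

overlined : Entry → Bool
overlined = proj₂

-- An array justified to the upper-left, given as its list of rows
-- (row i is the list of its entries from left to right).
Array : Set
Array = List (List Entry)

nth : {A : Set} → List A → ℕ → Maybe A
nth []       _       = nothing
nth (x ∷ xs) zero    = just x
nth (x ∷ xs) (suc j) = nth xs j

column : ℕ → Array → List Entry
column j = mapMaybe (λ r → nth r j)

WeaklyDecreasing : List Entry → Set
WeaklyDecreasing = AllPairs (λ e e′ → value e′ ≤ value e)

-- Row rule: only the last occurrence of an integer may be overlined,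
-- i.e. an earlier occurrence of a value that occurs again later is not overlined.
RowOverlineRule : List Entry → Set
RowOverlineRule = AllPairs (λ e e′ → value e ≡ value e′ → overlined e ≡ false)

ColumnOverlineRule : List Entry → Set
ColumnOverlineRule = AllPairs (λ e e′ → value e ≡ value e′ → overlined e′ ≡ true)

record IsPlaneOverpartition (A : Array) : Set where
  field
    rows-nonempty    : All (λ r → 0 < length r) A
    shape-partition  : AllPairs (λ r r′ → length r′ ≤ length r) A
    entries-positive : All (All (λ e → 0 < value e)) A
    rows-decreasing  : All WeaklyDecreasing A
    cols-decreasing  : ∀ j → WeaklyDecreasing (column j A)
    row-overlines    : All RowOverlineRule A
    col-overlines    : ∀ j → ColumnOverlineRule (column j A)

weight : Array → ℕ
weight A = sum (map value (concat A))

overlineCount : Array → ℕ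
overlineCount A = sum (map (λ e → if′ (overlined e)) (concat A))
  where
  if′ : Bool → ℕ
  if′ true  = 1
  if′ false = 0

PPO : ℕ → ℕ → Array → Set
PPO n k A = IsPlaneOverpartition A × weight A ≡ n × overlineCount A ≡ k

-- Two (finite) sets of arrays have the same number of elements:
-- a bijection between them.
record _≅_ (P Q : Array → Set) : Set where
  field
    to      : (A : Array) → P A → Array
    from    : (B : Array) → Q B → Array
    to-ok   : (A : Array) (p : P A) → Q (to A p)
    from-ok : (B : Array) (q : Q B) → P (from B q)
    from-to : (A : Array) (p : P A) → from (to A p) (to-ok A p) ≡ A
    to-from : (B : Array) (q : Q B) → to (from B q) (from-ok B q) ≡ B

-- Appending a row consisting of a single overlined 1 maps plane overpartitions
-- counted by pp̄ₖ(n) injectively into those counted by pp̄ₖ₊₁(n+1).  It is onto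
-- when 2n ≤ 3k: every row other than [1̄] satisfies 3·(overlines) ≤ 2·(weight),
-- because an overlined entry that is not last in its row is strictly larger than
-- its right neighbour, hence at least 2; and a row [1̄] can only be followed by
-- further rows [1̄].  So an overpartition of n+1 with k+1 overlines that did not
-- end in [1̄] would satisfy 3(k+1) ≤ 2(n+1), contradicting 2n ≤ 3k.
module Submission where

open import Defs
open import Data.Nat using (ℕ; zero; suc; _+_; _*_; _≤_; _<_; _≰_; z≤n; s≤s)
open import Data.Nat.Properties
open import Data.Bool using (true; false)
import Data.Maybe.Relation.Unary.All as Maybe
open import Data.Product using (_×_; _,_; proj₁; proj₂; ∃-syntax)
open import Data.Sum using (_⊎_; inj₁; inj₂)
open import Data.List using (List; []; _∷_; [_]; _++_; _∷ʳ_; map; concat)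
open import Data.List.Properties using (map-++; map-cong; concat-++; mapMaybe-++; ++-identityʳ; ∷ʳ-injectiveˡ)
open import Data.Nat.ListAction using (sum)
open import Data.Nat.ListAction.Properties using (sum-++)
open import Data.List.Relation.Unary.All using (All; []; _∷_)
import Data.List.Relation.Unary.All as All
import Data.List.Relation.Unary.All.Properties as All
open import Data.List.Relation.Unary.AllPairs using (AllPairs; []; _∷_)
import Data.List.Relation.Unary.AllPairs as AllPairs
import Data.List.Relation.Unary.AllPairs.Properties as AllPairs
open import Function using (_∘_)
open import Relation.Nullary using (contradiction)
open import Relation.Binary.PropositionalEquality hiding ([_])

open IsPlaneOverpartition

1̄ : Entry
1̄ = 1 , true

EndsWithOne̅ : Array → Set
EndsWithOne̅ A = ∃[ A′ ] A ≡ A′ ∷ʳ [ 1̄ ]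

overlineIndicator : Entry → ℕ
overlineIndicator (_ , true)  = 1
overlineIndicator (_ , false) = 0

rowWeight rowOverlines : List Entry → ℕ
rowWeight    = sum ∘ map value
rowOverlines = sum ∘ map overlineIndicator

OverlineBounded : List Entry → Set
OverlineBounded r = 3 * rowOverlines r ≤ 2 * rowWeight r

overlineCount≡rowOverlines-concat : ∀ A → overlineCount A ≡ rowOverlines (concat A)
overlineCount≡rowOverlines-concat A =
  cong sum (map-cong (λ { (_ , true) → refl ; (_ , false) → refl }) (concat A))

sum-map-++ : {X : Set} (f : X → ℕ) (xs ys : List X) →
  sum (map f (xs ++ ys)) ≡ sum (map f xs) + sum (map f ys)
sum-map-++ f xs ys = trans (cong sum (map-++ f xs ys)) (sum-++ (map f xs) (map f ys))

sum-map-concat-∷ʳ : {X : Set} (f : X → ℕ) (xss : List (List X)) (ys : List X) →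
  sum (map f (concat (xss ∷ʳ ys))) ≡ sum (map f (concat xss)) + sum (map f ys)
sum-map-concat-∷ʳ f xss ys = begin
  sum (map f (concat (xss ∷ʳ ys)))     ≡⟨ cong (sum ∘ map f) (concat-++ xss [ ys ]) ⟨
  sum (map f (concat xss ++ ys ++ [])) ≡⟨ cong (sum ∘ map f ∘ (concat xss ++_)) (++-identityʳ ys) ⟩
  sum (map f (concat xss ++ ys))       ≡⟨ sum-map-++ f (concat xss) ys ⟩
  sum (map f (concat xss)) + sum (map f ys) ∎
  where open ≡-Reasoning

weight-∷ʳ-one̅ : ∀ A → weight (A ∷ʳ [ 1̄ ]) ≡ suc (weight A)
weight-∷ʳ-one̅ A = trans (sum-map-concat-∷ʳ value A [ 1̄ ]) (+-comm (weight A) 1)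

overlineCount-∷ʳ-one̅ : ∀ A → overlineCount (A ∷ʳ [ 1̄ ]) ≡ suc (overlineCount A)
overlineCount-∷ʳ-one̅ A = begin
  overlineCount (A ∷ʳ [ 1̄ ])          ≡⟨ overlineCount≡rowOverlines-concat (A ∷ʳ [ 1̄ ]) ⟩
  rowOverlines (concat (A ∷ʳ [ 1̄ ])) ≡⟨ sum-map-concat-∷ʳ overlineIndicator A [ 1̄ ] ⟩
  rowOverlines (concat A) + 1         ≡⟨ +-comm (rowOverlines (concat A)) 1 ⟩
  suc (rowOverlines (concat A))       ≡⟨ cong suc (overlineCount≡rowOverlines-concat A) ⟨
  suc (overlineCount A)               ∎
  where open ≡-Reasoning

column-++ : ∀ j A B → column j (A ++ B) ≡ column j A ++ column j B
column-++ j = mapMaybe-++ (λ r → nth r j)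

All-nth : ∀ {P : Entry → Set} {r} j → All P r → Maybe.All P (nth r j)
All-nth j       []       = Maybe.nothing
All-nth zero    (pe ∷ _) = Maybe.just pe
All-nth (suc j) (_ ∷ pr) = All-nth j pr

All-column : ∀ {P : Entry → Set} {A} j → All (All P) A → All P (column j A)
All-column j pA = All.mapMaybe⁺ (All.map⁺ (All.map (All-nth j) pA))

AllPairs-++⁻ : ∀ {X : Set} {R : X → X → Set} xs {ys} →
  AllPairs R (xs ++ ys) → AllPairs R xs × AllPairs R ys
AllPairs-++⁻ []       p          = [] , p
AllPairs-++⁻ (x ∷ xs) (px ∷ pxs) =
  All.++⁻ˡ xs px ∷ proj₁ (AllPairs-++⁻ xs pxs) , proj₂ (AllPairs-++⁻ xs pxs)

isPlaneOverpartition-++⁻ : ∀ A {B} →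
  IsPlaneOverpartition (A ++ B) → IsPlaneOverpartition A × IsPlaneOverpartition B
isPlaneOverpartition-++⁻ A {B} p =
  record
    { rows-nonempty    = proj₁ (All.++⁻ A (rows-nonempty p))
    ; shape-partition  = proj₁ (AllPairs-++⁻ A (shape-partition p))
    ; entries-positive = proj₁ (All.++⁻ A (entries-positive p))
    ; rows-decreasing  = proj₁ (All.++⁻ A (rows-decreasing p))
    ; cols-decreasing  = proj₁ ∘ columns⁻ (cols-decreasing p)
    ; row-overlines    = proj₁ (All.++⁻ A (row-overlines p))
    ; col-overlines    = proj₁ ∘ columns⁻ (col-overlines p)
    } ,
  record
    { rows-nonempty    = proj₂ (All.++⁻ A (rows-nonempty p))
    ; shape-partition  = proj₂ (AllPairs-++⁻ A (shape-partition p))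
    ; entries-positive = proj₂ (All.++⁻ A (entries-positive p))
    ; rows-decreasing  = proj₂ (All.++⁻ A (rows-decreasing p))
    ; cols-decreasing  = proj₂ ∘ columns⁻ (cols-decreasing p)
    ; row-overlines    = proj₂ (All.++⁻ A (row-overlines p))
    ; col-overlines    = proj₂ ∘ columns⁻ (col-overlines p)
    }
  where
  columns⁻ : ∀ {R : Entry → Entry → Set} → (∀ j → AllPairs R (column j (A ++ B))) →
    ∀ j → AllPairs R (column j A) × AllPairs R (column j B)
  columns⁻ q j = AllPairs-++⁻ (column j A) (subst (AllPairs _) (column-++ j A B) (q j))

columns-∷ʳ-one̅⁺ : ∀ {R : Entry → Entry → Set} A → (∀ j → AllPairs R (column j A)) →
  All (λ e → R e 1̄) (column 0 A) → ∀ j → AllPairs R (column j (A ∷ʳ [ 1̄ ]))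
columns-∷ʳ-one̅⁺ A q r zero = subst (AllPairs _) (sym (column-++ 0 A _))
  (AllPairs.++⁺ (q 0) ([] ∷ []) (All.map (_∷ []) r))
columns-∷ʳ-one̅⁺ A q r (suc j) = subst (AllPairs _)
  (sym (trans (column-++ (suc j) A _) (++-identityʳ (column (suc j) A)))) (q (suc j))

isPlaneOverpartition-∷ʳ-one̅⁺ : ∀ {A} → IsPlaneOverpartition A → IsPlaneOverpartition (A ∷ʳ [ 1̄ ])
isPlaneOverpartition-∷ʳ-one̅⁺ {A} p = record
  { rows-nonempty    = All.++⁺ (rows-nonempty p) (s≤s z≤n ∷ [])
  ; shape-partition  = AllPairs.++⁺ (shape-partition p) ([] ∷ [])
                         (All.map (_∷ []) (rows-nonempty p))
  ; entries-positive = All.++⁺ (entries-positive p) ((s≤s z≤n ∷ []) ∷ [])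
  ; rows-decreasing  = All.++⁺ (rows-decreasing p) (([] ∷ []) ∷ [])
  ; cols-decreasing  = columns-∷ʳ-one̅⁺ A (cols-decreasing p) (All-column 0 (entries-positive p))
  ; row-overlines    = All.++⁺ (row-overlines p) (([] ∷ []) ∷ [])
  ; col-overlines    = columns-∷ʳ-one̅⁺ A (col-overlines p) (All.universal (λ _ _ → refl) _)
  }

RowConditions : List Entry → Set
RowConditions r = All (λ e → 0 < value e) r × WeaklyDecreasing r × RowOverlineRule r

rowConditions : ∀ {r A} → IsPlaneOverpartition (r ∷ A) → RowConditions r
rowConditions p = All.head (entries-positive p) , All.head (rows-decreasing p) , All.head (row-overlines p)

rowConditions-tail : ∀ {e r} → RowConditions (e ∷ r) → RowConditions r
rowConditions-tail (pos , dec , ovl) = All.tail pos , AllPairs.tail dec , AllPairs.tail ovl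

overlined-not-last⇒2≤value : ∀ {v e r} → RowConditions ((v , true) ∷ e ∷ r) → 2 ≤ v
overlined-not-last⇒2≤value (_ ∷ 0<e ∷ _ , (e≤v ∷ _) ∷ _ , (ovl ∷ _) ∷ _) =
  ≤-trans (s≤s 0<e) (≤∧≢⇒< e≤v (λ e≡v → contradiction (ovl (sym e≡v)) λ ()))

3d+1≤2v⇒3[d+x]≤2[v+y] : ∀ d v x y → 3 * d + 1 ≤ 2 * v → 3 * x ≤ 2 * y + 1 →
  3 * (d + x) ≤ 2 * (v + y)
3d+1≤2v⇒3[d+x]≤2[v+y] d v x y slack bound = begin
  3 * (d + x)           ≡⟨ *-distribˡ-+ 3 d x ⟩
  3 * d + 3 * x         ≤⟨ +-monoʳ-≤ (3 * d) bound ⟩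
  3 * d + (2 * y + 1)   ≡⟨ cong (3 * d +_) (+-comm (2 * y) 1) ⟩
  3 * d + (1 + 2 * y)   ≡⟨ +-assoc (3 * d) 1 (2 * y) ⟨
  3 * d + 1 + 2 * y     ≤⟨ +-monoˡ-≤ (2 * y) slack ⟩
  2 * v + 2 * y         ≡⟨ *-distribˡ-+ 2 v y ⟨
  2 * (v + y)           ∎
  where open ≤-Reasoning

-- An entry with a right neighbour has 3·(its overlines) + 1 ≤ 2·(its value);
-- the + 1 absorbs the slack in the bound for the rest of the row.
overlineBounded-∷∷ : ∀ {e e′ r} → RowConditions (e ∷ e′ ∷ r) →
  3 * rowOverlines (e′ ∷ r) ≤ 2 * rowWeight (e′ ∷ r) + 1 →
  OverlineBounded (e ∷ e′ ∷ r)
overlineBounded-∷∷ {v , false} {e′} {r} (0<v ∷ _ , _) =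
  3d+1≤2v⇒3[d+x]≤2[v+y] 0 v (rowOverlines (e′ ∷ r)) (rowWeight (e′ ∷ r))
    (≤-trans 0<v (m≤m+n v _))
overlineBounded-∷∷ {v , true} {e′} {r} c =
  3d+1≤2v⇒3[d+x]≤2[v+y] 1 v (rowOverlines (e′ ∷ r)) (rowWeight (e′ ∷ r))
    (*-monoʳ-≤ 2 (overlined-not-last⇒2≤value c))

rowOverlines-≤-rowWeight+1 : ∀ r → RowConditions r → 3 * rowOverlines r ≤ 2 * rowWeight r + 1
rowOverlines-≤-rowWeight+1 []                 _             = z≤n
rowOverlines-≤-rowWeight+1 ((_ , false) ∷ []) _             = z≤n
rowOverlines-≤-rowWeight+1 ((v , true) ∷ [])  (0<v ∷ _ , _) =
  +-monoˡ-≤ 1 (*-monoʳ-≤ 2 (≤-trans 0<v (m≤m+n v 0)))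
rowOverlines-≤-rowWeight+1 (e ∷ e′ ∷ r)       c             = m≤n⇒m≤n+o 1
  (overlineBounded-∷∷ c (rowOverlines-≤-rowWeight+1 (e′ ∷ r) (rowConditions-tail c)))

row≡one̅⊎overlineBounded : ∀ {r} → RowConditions r → r ≡ [ 1̄ ] ⊎ OverlineBounded r
row≡one̅⊎overlineBounded {[]}                       _            = inj₂ z≤n
row≡one̅⊎overlineBounded {(_ , false) ∷ []}          _            = inj₂ z≤n
row≡one̅⊎overlineBounded {(0 , true) ∷ []}           (() ∷ _ , _)
row≡one̅⊎overlineBounded {(1 , true) ∷ []}           _            = inj₁ refl
row≡one̅⊎overlineBounded {(suc (suc _) , true) ∷ []} _            =
  inj₂ (≤-trans (n≤1+n 3) (*-monoʳ-≤ 2 (s≤s (s≤s z≤n))))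
row≡one̅⊎overlineBounded {_ ∷ e′ ∷ r}                c            =
  inj₂ (overlineBounded-∷∷ c (rowOverlines-≤-rowWeight+1 (e′ ∷ r) (rowConditions-tail c)))

-- The shape forces a single entry, and column 0 squeezes it between 1 and 1̄.
row-below-one̅ : ∀ {r A} → IsPlaneOverpartition ([ 1̄ ] ∷ r ∷ A) → r ≡ [ 1̄ ]
row-below-one̅ {[]} p =
  contradiction (All.head (All.tail (rows-nonempty p))) λ ()
row-below-one̅ {_ ∷ _ ∷ _} p =
  contradiction (All.head (AllPairs.head (shape-partition p))) λ { (s≤s ()) }
row-below-one̅ {(0 , _) ∷ []} p =
  contradiction (All.head (All.head (All.tail (entries-positive p)))) λ ()
row-below-one̅ {(suc (suc _) , _) ∷ []} p =
  contradiction (All.head (AllPairs.head (cols-decreasing p 0))) λ { (s≤s ()) }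
row-below-one̅ {(1 , false) ∷ []} p =
  contradiction (All.head (AllPairs.head (col-overlines p 0)) refl) λ ()
row-below-one̅ {(1 , true) ∷ []} _ = refl

endsWithOne̅-∷ : ∀ {r A} → EndsWithOne̅ A → EndsWithOne̅ (r ∷ A)
endsWithOne̅-∷ {r} (A′ , A≡A′∷ʳ1̄) = r ∷ A′ , cong (r ∷_) A≡A′∷ʳ1̄

endsWithOne̅-from-one̅ : ∀ {A} → IsPlaneOverpartition ([ 1̄ ] ∷ A) → EndsWithOne̅ ([ 1̄ ] ∷ A)
endsWithOne̅-from-one̅ {[]}    _ = [] , refl
endsWithOne̅-from-one̅ {r ∷ A} p with refl ← row-below-one̅ p =
  endsWithOne̅-∷ (endsWithOne̅-from-one̅ (proj₂ (isPlaneOverpartition-++⁻ [ [ 1̄ ] ] p)))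

overlineBounded-++ : ∀ xs ys → OverlineBounded xs → OverlineBounded ys → OverlineBounded (xs ++ ys)
overlineBounded-++ xs ys bxs bys = begin
  3 * rowOverlines (xs ++ ys)                   ≡⟨ cong (3 *_) (sum-map-++ overlineIndicator xs ys) ⟩
  3 * (rowOverlines xs + rowOverlines ys)       ≡⟨ *-distribˡ-+ 3 (rowOverlines xs) _ ⟩
  3 * rowOverlines xs + 3 * rowOverlines ys     ≤⟨ +-mono-≤ bxs bys ⟩
  2 * rowWeight xs + 2 * rowWeight ys           ≡⟨ *-distribˡ-+ 2 (rowWeight xs) _ ⟨
  2 * (rowWeight xs + rowWeight ys)             ≡⟨ cong (2 *_) (sum-map-++ value xs ys) ⟨
  2 * rowWeight (xs ++ ys)                      ∎
  where open ≤-Reasoning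

endsWithOne̅⊎overlineBounded : ∀ A → IsPlaneOverpartition A →
  EndsWithOne̅ A ⊎ OverlineBounded (concat A)
endsWithOne̅⊎overlineBounded []      _ = inj₂ z≤n
endsWithOne̅⊎overlineBounded (r ∷ A) p
  with row≡one̅⊎overlineBounded (rowConditions p)
     | endsWithOne̅⊎overlineBounded A (proj₂ (isPlaneOverpartition-++⁻ [ r ] p))
... | inj₁ refl  | _           = inj₁ (endsWithOne̅-from-one̅ p)
... | inj₂ _     | inj₁ ends   = inj₁ (endsWithOne̅-∷ ends)
... | inj₂ bound | inj₂ bound′ = inj₂ (overlineBounded-++ r (concat A) bound bound′)

PPO-∷ʳ-one̅⁺ : ∀ {n k A} → PPO n k A → PPO (suc n) (suc k) (A ∷ʳ [ 1̄ ])
PPO-∷ʳ-one̅⁺ {A = A} (p , w , o) =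
  isPlaneOverpartition-∷ʳ-one̅⁺ p ,
  trans (weight-∷ʳ-one̅ A) (cong suc w) ,
  trans (overlineCount-∷ʳ-one̅ A) (cong suc o)

PPO-∷ʳ-one̅⁻ : ∀ {n k A} → PPO (suc n) (suc k) (A ∷ʳ [ 1̄ ]) → PPO n k A
PPO-∷ʳ-one̅⁻ {A = A} (p , w , o) =
  proj₁ (isPlaneOverpartition-++⁻ A p) ,
  suc-injective (trans (sym (weight-∷ʳ-one̅ A)) w) ,
  suc-injective (trans (sym (overlineCount-∷ʳ-one̅ A)) o)

PPO≅PPO-suc-suc : ∀ {n k} → (∀ B → PPO (suc n) (suc k) B → EndsWithOne̅ B) →
  PPO n k ≅ PPO (suc n) (suc k)
PPO≅PPO-suc-suc ends = record
  { to      = λ A _ → A ∷ʳ [ 1̄ ]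
  ; from    = λ B q → proj₁ (ends B q)
  ; to-ok   = λ _ → PPO-∷ʳ-one̅⁺
  ; from-ok = λ B q → PPO-∷ʳ-one̅⁻ (subst (PPO _ _) (proj₂ (ends B q)) q)
  ; from-to = λ A p → sym (∷ʳ-injectiveˡ A _ (proj₂ (ends (A ∷ʳ [ 1̄ ]) (PPO-∷ʳ-one̅⁺ p))))
  ; to-from = λ B q → sym (proj₂ (ends B q))
  }

2n≤3k⇒3[1+k]≰2[1+n] : ∀ {n k} → 2 * n ≤ 3 * k → 3 * suc k ≰ 2 * suc n
2n≤3k⇒3[1+k]≰2[1+n] {n} {k} 2n≤3k = <⇒≱ (begin-strict
  2 * suc n ≡⟨ *-suc 2 n ⟩
  2 + 2 * n ≤⟨ +-monoʳ-≤ 2 2n≤3k ⟩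
  2 + 3 * k <⟨ n<1+n (2 + 3 * k) ⟩
  3 + 3 * k ≡⟨ *-suc 3 k ⟨
  3 * suc k ∎)
  where open ≤-Reasoning

corollary3 : (n k : ℕ) → 2 * n ≤ 3 * k → PPO n k ≅ PPO (suc n) (suc k)
corollary3 n k 2n≤3k = PPO≅PPO-suc-suc endsWithOne̅
  where
  endsWithOne̅ : ∀ B → PPO (suc n) (suc k) B → EndsWithOne̅ B
  endsWithOne̅ B (p , w , o) with endsWithOne̅⊎overlineBounded B p
  ... | inj₁ ends  = ends
  ... | inj₂ bound = contradiction
    (subst₂ (λ x y → 3 * x ≤ 2 * y) (trans (sym (overlineCount≡rowOverlines-concat B)) o) w bound)
    (2n≤3k⇒3[1+k]≰2[1+n] 2n≤3k)
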